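{- Let $H$ be a finite group, $D\subseteq H$, and let $\mathcal{D}:=\{Dh\mid h\in H\}$ be the Cayley design generated by $D$ (point set $H$, block set $\mathcal{D}$), and assume $|\mathcal{D}|=|H|$. Let $G$ be a subgroup of $\mathrm{Aut}(\mathcal{D})$ which contains $H_\ast=\{h_\ast\mid h\in H\}$, where $h_\ast$ is the right translation $x\mapsto xh$. Let $p\in H$ and assume that the point stabilizer $G_p$ fixes some block $B\in\mathcal{D}$. Then: (1) if $G_p$ fixes a point $q\in H$, then $G_p$ also fixes the block $Bp^{ -1}q$; (2) if $G_p$ fixes a block $Bh$ with $h\in H$, then $G_p$ also fixes the point $ph^{ -1}$; (3) there exists a subgroup $F\leq H$ such that $\mathrm{fix}_H(G_p)=\{pf\mid f\in F\}$ and $\mathrm{fix}_{\mathcal{D}}(G_B)=\{Bf\mid f\in F\}$.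
   Context: $\mathrm{Aut}(\mathcal{D})$ is the group of all permutations of $H$ that map blocks of $\mathcal{D}$ to blocks of $\mathcal{D}$; permutations act on the right, $x^{g}$ denoting the image of $x$ under $g$, and blocks are moved setwise. $G_p$ is the stabilizer of the point $p$ in $G$, $G_B$ the stabilizer of the block $B$ in $G$. $\mathrm{fix}_H(G_p)$ is the set of points of $H$ fixed by every element of $G_p$, and $\mathrm{fix}_{\mathcal{D}}(G_B)$ the set of blocks fixed by every element of $G_B$. -}

module Defs where

open import Level using (0ℓ)
open import Data.Nat using (ℕ)
open import Data.Fin using (Fin)
open import Data.Fin.Subset using (Subset)
open import Data.Fin.Permutation using (Permutation′; _⟨$⟩ʳ_; _⟨$⟩ˡ_; permutation; id; flip; _∘ₚ_)
open import Data.Bool using (Bool)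
import Data.Bool as Bool
open import Data.Vec using (tabulate; lookup)
open import Data.Vec.Properties using (≡-dec)
open import Data.List using (List; map; length; deduplicate)
open import Data.List.Base using () renaming (allFin to allFinL)
open import Data.Product using (Σ; ∃; _×_)
open import Relation.Binary.PropositionalEquality using (_≡_; refl; sym; trans; cong)
open import Algebra.Structures using (IsGroup)
open import Function.Bundles using (_⇔_)

-- A finite group H, realised (up to isomorphism) as a group structure on
-- the n-element set Fin n, with propositional equality.
record FinGroup (n : ℕ) : Set where
  field
    _∙_     : Fin n → Fin n → Fin n
    ε       : Fin n
    _⁻¹     : Fin n → Fin n
    isGroup : IsGroup _≡_ _∙_ ε _⁻¹
  infixl 7 _∙_
  infix 8 _⁻¹
  open IsGroup isGroup public using (assoc; identityˡ; identityʳ; inverseˡ; inverseʳ)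

module _ {n : ℕ} (H : FinGroup n) where
  open FinGroup H

  -- Right translate of a subset:  S h = { x h | x ∈ S },
  -- so  y ∈ S h  iff  y h⁻¹ ∈ S.
  translate : Subset n → Fin n → Subset n
  translate S h = tabulate (λ y → lookup S (y ∙ h ⁻¹))

  blockList : Subset n → List (Subset n)
  blockList D = map (translate D) (allFinL n)

  numBlocks : Subset n → ℕ
  numBlocks D = length (deduplicate (≡-dec Bool._≟_) (blockList D))

  IsBlock : Subset n → Subset n → Set
  IsBlock D B = ∃ λ h → B ≡ translate D h

  rightTrans : Fin n → Permutation′ n
  rightTrans h = permutation (λ x → x ∙ h) (λ x → x ∙ h ⁻¹)
    (λ x → trans (assoc x (h ⁻¹) h) (trans (cong (x ∙_) (inverseˡ h)) (identityʳ x)))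
    (λ x → trans (assoc x h (h ⁻¹)) (trans (cong (x ∙_) (inverseʳ h)) (identityʳ x)))

-- Image  S^g = { x^g | x ∈ S }  of a subset under a permutation g
-- (x^g is written  g ⟨$⟩ʳ x ), so  y ∈ S^g  iff  y^(g⁻¹) ∈ S.
imageSet : {n : ℕ} → Permutation′ n → Subset n → Subset n
imageSet g S = tabulate (λ y → lookup S (g ⟨$⟩ˡ y))

module _ {n : ℕ} (H : FinGroup n) where
  open FinGroup H

  IsAut : Subset n → Permutation′ n → Set
  IsAut D g = ∀ h → IsBlock H D (imageSet g (translate H D h))

record IsPermSubgroup {n : ℕ} (G : Permutation′ n → Set) : Set where
  field
    ext     : ∀ g g′ → (∀ x → g ⟨$⟩ʳ x ≡ g′ ⟨$⟩ʳ x) → G g → G g′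
    has-id  : G id
    has-∘   : ∀ g g′ → G g → G g′ → G (g ∘ₚ g′)
    has-inv : ∀ g → G g → G (flip g)

record IsSubgroup {n : ℕ} (H : FinGroup n) (F : Fin n → Set) : Set where
  open FinGroup H
  field
    has-ε   : F ε
    has-∙   : ∀ x y → F x → F y → F (x ∙ y)
    has-inv : ∀ x → F x → F (x ⁻¹)

module _ {n : ℕ} (G : Permutation′ n → Set) where
  StabFixesPoint : Fin n → Fin n → Set
  StabFixesPoint p q = ∀ g → G g → g ⟨$⟩ʳ p ≡ p → g ⟨$⟩ʳ q ≡ q

  StabFixesBlock : Fin n → Subset n → Set
  StabFixesBlock p C = ∀ g → G g → g ⟨$⟩ʳ p ≡ p → imageSet g C ≡ C

  BlockStabFixesBlock : Subset n → Subset n → Set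
  BlockStabFixesBlock B C = ∀ g → G g → imageSet g B ≡ B → imageSet g C ≡ C

-- Since |𝒟| = |H|, the translates D h are pairwise distinct, so H_* acts regularly on the blocks.
-- Conjugating by right translations turns G_p ⊆ G_B into G_p = G_B, and then into
-- G_{ph} = G_{Bh} for every h. So with F = { f | G_p fixes p f }, the fixed points of G_p are p F
-- and the blocks fixed by G_B = G_p are B F; F is closed under products (conjugate once more)
-- and, H being finite, under inverses, since each inverse is a positive power.

module Submission where

open import Defs
open import Level using (0ℓ)
open import Data.Nat using (ℕ; zero; suc; _+_; _≤_)
open import Data.Nat.Properties using (≤-antisym; suc-injective; +-suc; n<1+n; m≤n⇒∃[o]m+o≡n)
open import Data.Fin using (Fin; toℕ)
open import Data.Fin.Properties using (pigeonhole)
open import Data.Fin.Subset using (Subset)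
open import Data.Fin.Permutation using (Permutation′; _⟨$⟩ʳ_; _⟨$⟩ˡ_; _∘ₚ_)
import Data.Bool as Bool
open import Data.Vec using (tabulate; lookup)
open import Data.Vec.Properties using (≡-dec; tabulate-cong; lookup∘tabulate; tabulate∘lookup)
open import Data.List using ([]; _∷_; length; deduplicate; filter)
import Data.List as List
open import Data.List.Base using () renaming (allFin to allFinL)
open import Data.List.Properties using (length-deduplicate; length-filter; filter-complete; length-map; length-tabulate; map-tabulate)
open import Data.List.Membership.Propositional.Properties using (∈-deduplicate⁺)
open import Data.List.Relation.Unary.All as All using (All)
open import Data.List.Relation.Unary.All.Properties using (all-filter; tabulate⁻)
open import Data.List.Relation.Unary.Unique.Propositional using (Unique; _∷_; [])
open import Data.Product using (Σ; ∃; _×_; _,_)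
open import Relation.Binary.PropositionalEquality
open import Relation.Binary.Definitions using (DecidableEquality)
open import Relation.Nullary using (¬_; ¬?; contradiction)
open import Function using (_∘_; id)
open import Function.Bundles using (_⇔_; mk⇔; Equivalence)
open import Algebra.Bundles using (Group)
import Algebra.Properties.Group as GroupProperties
import Algebra.Properties.Monoid.Mult as MonoidMult
import Relation.Binary.Reasoning.Setoid as SetoidReasoning
open import Function.Properties.Equivalence using (⇔-setoid)

open Equivalence using (to; from)

module ⇔-Reasoning = SetoidReasoning (⇔-setoid 0ℓ)

module _ {A : Set} (_≟_ : DecidableEquality A) where

  length-deduplicate≡⇒Unique : ∀ xs → length (deduplicate _≟_ xs) ≡ length xs → Unique xs
  length-deduplicate≡⇒Unique []       _  = []
  length-deduplicate≡⇒Unique (x ∷ xs) eq = x∉xs ∷ length-deduplicate≡⇒Unique xs dd≡xs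
    where
      x≢? = ¬? ∘ (x ≟_)
      dd = deduplicate _≟_ xs
      -- deduplicate (x ∷ xs) is x ∷ filter (x ≢_) dd; a length count shows that neither
      -- the filter nor dd loses anything.
      filter≡xs : length (filter x≢? dd) ≡ length xs
      filter≡xs = suc-injective eq
      filter≡dd : length (filter x≢? dd) ≡ length dd
      filter≡dd = ≤-antisym (length-filter x≢? dd)
        (subst (length dd ≤_) (sym filter≡xs) (length-deduplicate _≟_ xs))
      dd≡xs : length dd ≡ length xs
      dd≡xs = trans (sym filter≡dd) filter≡xs
      x∉dd : All (λ y → ¬ x ≡ y) dd
      x∉dd = subst (All _) (filter-complete x≢? filter≡dd) (all-filter x≢? dd)
      x∉xs : All (λ y → ¬ x ≡ y) xs
      x∉xs = All.tabulate λ y∈xs → All.lookup x∉dd (∈-deduplicate⁺ _≟_ y∈xs)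

Unique[tabulate]⇒injective : ∀ {A : Set} {n} {f : Fin n → A} → Unique (List.tabulate f)
  → ∀ {i j} → f i ≡ f j → i ≡ j
Unique[tabulate]⇒injective _            {Fin.zero}  {Fin.zero}  _ = refl
Unique[tabulate]⇒injective (f₀∉ ∷ _)    {Fin.zero}  {Fin.suc j} e = contradiction e (tabulate⁻ f₀∉ j)
Unique[tabulate]⇒injective (f₀∉ ∷ _)    {Fin.suc i} {Fin.zero}  e = contradiction (sym e) (tabulate⁻ f₀∉ i)
Unique[tabulate]⇒injective (_ ∷ unique) {Fin.suc i} {Fin.suc j} e =
  cong Fin.suc (Unique[tabulate]⇒injective unique e)

toGroup : ∀ {n} → FinGroup n → Group 0ℓ 0ℓ
toGroup H = record { FinGroup H; _≈_ = _≡_ }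

module FiniteGroup {n : ℕ} (H : FinGroup n) where
  open FinGroup H
  open GroupProperties (toGroup H)
  open MonoidMult (Group.monoid (toGroup H)) using (×-homo-+) renaming (_×_ to _times_)

  infixr 8 _^_
  _^_ : Fin n → ℕ → Fin n
  a ^ k = k times a

  inverse-is-power : ∀ a → ∃ λ k → a ^ k ≡ a ⁻¹
  inverse-is-power a with pigeonhole (n<1+n n) (λ i → a ^ toℕ i)
  ... | i , j , i<j , aⁱ≡aʲ with m≤n⇒∃[o]m+o≡n i<j
  ... | k , i+1+k≡j = k , inverseʳ-unique a (a ^ k) a∙aᵏ≡ε
    where
      open ≡-Reasoning
      a∙aᵏ≡ε : a ∙ a ^ k ≡ ε
      a∙aᵏ≡ε = identityʳ-unique (a ^ toℕ i) _ (sym (begin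
        a ^ toℕ i                 ≡⟨ aⁱ≡aʲ ⟩
        a ^ toℕ j                 ≡⟨ cong (a ^_) (sym (trans (+-suc (toℕ i) k) i+1+k≡j)) ⟩
        a ^ (toℕ i + suc k)       ≡⟨ ×-homo-+ a (toℕ i) (suc k) ⟩
        a ^ toℕ i ∙ (a ∙ a ^ k)   ∎))

  submonoid⇒subgroup : (F : Fin n → Set) → F ε → (∀ x y → F x → F y → F (x ∙ y)) → IsSubgroup H F
  submonoid⇒subgroup F Fε F∙ = record { has-ε = Fε ; has-∙ = F∙ ; has-inv = F⁻¹ }
    where
      F^ : ∀ {a} → F a → ∀ k → F (a ^ k)
      F^ Fa zero    = Fε
      F^ Fa (suc k) = F∙ _ _ Fa (F^ Fa k)
      F⁻¹ : ∀ x → F x → F (x ⁻¹)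
      F⁻¹ x Fx with k , xᵏ≡x⁻¹ ← inverse-is-power x = subst F xᵏ≡x⁻¹ (F^ Fx k)

FixesPoint : ∀ {n} → Permutation′ n → Fin n → Set
FixesPoint g x = g ⟨$⟩ʳ x ≡ x

FixesSet : ∀ {n} → Permutation′ n → Subset n → Set
FixesSet g S = imageSet g S ≡ S

module RightTranslation {n : ℕ} (H : FinGroup n) where
  open FinGroup H
  open GroupProperties (toGroup H)
  open ≡-Reasoning

  translate-∙ : ∀ S a b → translate H (translate H S a) b ≡ translate H S (a ∙ b)
  translate-∙ S a b = tabulate-cong λ y → begin
    lookup (translate H S a) (y ∙ b ⁻¹)  ≡⟨ lookup∘tabulate _ (y ∙ b ⁻¹) ⟩
    lookup S (y ∙ b ⁻¹ ∙ a ⁻¹)           ≡⟨ cong (lookup S) (assoc y (b ⁻¹) (a ⁻¹)) ⟩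
    lookup S (y ∙ (b ⁻¹ ∙ a ⁻¹))         ≡⟨ cong (lookup S ∘ (y ∙_)) (⁻¹-anti-homo-∙ a b) ⟨
    lookup S (y ∙ (a ∙ b) ⁻¹)            ∎

  translate-ε : ∀ S → translate H S ε ≡ S
  translate-ε S = begin
    tabulate (λ y → lookup S (y ∙ ε ⁻¹))  ≡⟨ tabulate-cong (λ y → cong (lookup S ∘ (y ∙_)) ε⁻¹≈ε) ⟩
    tabulate (λ y → lookup S (y ∙ ε))     ≡⟨ tabulate-cong (λ y → cong (lookup S) (identityʳ y)) ⟩
    tabulate (lookup S)                   ≡⟨ tabulate∘lookup S ⟩
    S                                     ∎

  translate-cancel : ∀ S {a b} → a ∙ b ≡ ε → translate H (translate H S a) b ≡ S
  translate-cancel S {a} {b} ab≡ε = begin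
    translate H (translate H S a) b  ≡⟨ translate-∙ S a b ⟩
    translate H S (a ∙ b)            ≡⟨ cong (translate H S) ab≡ε ⟩
    translate H S ε                  ≡⟨ translate-ε S ⟩
    S                                ∎

  -- Conjugation  h_* g h⁻¹_*  (composition in _∘ₚ_ is left to right): x ↦ (x h)^g h⁻¹.
  conj : Fin n → Permutation′ n → Permutation′ n
  conj h g = rightTrans H h ∘ₚ (g ∘ₚ rightTrans H (h ⁻¹))

  imageSet-conj : ∀ h g S → imageSet (conj h g) S ≡ translate H (imageSet g (translate H S h)) (h ⁻¹)
  imageSet-conj h g S = tabulate-cong λ y → sym (begin
    lookup (imageSet g (translate H S h)) (y ∙ h ⁻¹ ⁻¹)  ≡⟨ lookup∘tabulate _ (y ∙ h ⁻¹ ⁻¹) ⟩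
    lookup (translate H S h) (g ⟨$⟩ˡ (y ∙ h ⁻¹ ⁻¹))      ≡⟨ lookup∘tabulate (λ z → lookup S (z ∙ h ⁻¹)) _ ⟩
    lookup S ((g ⟨$⟩ˡ (y ∙ h ⁻¹ ⁻¹)) ∙ h ⁻¹)             ∎)

  imageSet-∘-rightTrans : ∀ g c S → imageSet (g ∘ₚ rightTrans H c) S ≡ translate H (imageSet g S) c
  imageSet-∘-rightTrans g c S = tabulate-cong λ y → sym (lookup∘tabulate _ (y ∙ c ⁻¹))

  conj-fixesPoint : ∀ h g x → FixesPoint (conj h g) x ⇔ FixesPoint g (x ∙ h)
  conj-fixesPoint h g x = mk⇔
    (λ fixed → trans (sym (//-rightDividesˡ h _)) (cong (_∙ h) fixed))
    (λ fixed → trans (cong (_∙ h ⁻¹) fixed) (//-rightDividesʳ h x))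

  conj-fixesSet : ∀ h g S → FixesSet (conj h g) S ⇔ FixesSet g (translate H S h)
  conj-fixesSet h g S = mk⇔
    (λ fixed → begin
      imageSet g (translate H S h)
        ≡⟨ translate-cancel _ (inverseˡ h) ⟨
      translate H (translate H (imageSet g (translate H S h)) (h ⁻¹)) h
        ≡⟨ cong (λ T → translate H T h) (imageSet-conj h g S) ⟨
      translate H (imageSet (conj h g) S) h
        ≡⟨ cong (λ T → translate H T h) fixed ⟩
      translate H S h
        ∎)
    (λ fixed → begin
      imageSet (conj h g) S                                 ≡⟨ imageSet-conj h g S ⟩
      translate H (imageSet g (translate H S h)) (h ⁻¹)     ≡⟨ cong (λ T → translate H T (h ⁻¹)) fixed ⟩
      translate H (translate H S h) (h ⁻¹)                  ≡⟨ translate-cancel S (inverseʳ h) ⟩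
      S                                                     ∎)

module Stabilisers {n : ℕ} (H : FinGroup n)
    (G : Permutation′ n → Set) (G-subgroup : IsPermSubgroup G)
    (G-rightTrans : ∀ h → G (rightTrans H h))
    (p : Fin n) (B : Subset n)
    (B-regular : ∀ c → translate H B c ≡ B → c ≡ FinGroup.ε H)
    (Gₚ-fixes-B : StabFixesBlock G p B) where
  open FinGroup H
  open GroupProperties (toGroup H)
  open IsPermSubgroup G-subgroup
  open RightTranslation H

  conj-closed : ∀ h g → G g → G (conj h g)
  conj-closed h g Gg = has-∘ _ _ (G-rightTrans h) (has-∘ _ _ Gg (G-rightTrans (h ⁻¹)))

  -- With q = p^g, the permutation g (q⁻¹ p)_* fixes p, hence B; it moves B to B^g (q⁻¹ p) = B (q⁻¹ p),
  -- so regularity forces q⁻¹ p = ε.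
  fixesSet⇒fixesPoint : ∀ g → G g → FixesSet g B → FixesPoint g p
  fixesSet⇒fixesPoint g Gg g-fixes-B =
    sym (∙-cancelˡ (q ⁻¹) p q (trans (B-regular c Bc≡B) (sym (inverseˡ q))))
    where
      q = g ⟨$⟩ʳ p
      c = q ⁻¹ ∙ p
      g′ = g ∘ₚ rightTrans H c
      g′-fixes-B : FixesSet g′ B
      g′-fixes-B = Gₚ-fixes-B g′ (has-∘ _ _ Gg (G-rightTrans c)) (\\-leftDividesˡ q p)
      Bc≡B : translate H B c ≡ B
      Bc≡B = begin
        translate H B c               ≡⟨ cong (λ T → translate H T c) g-fixes-B ⟨
        translate H (imageSet g B) c  ≡⟨ imageSet-∘-rightTrans g c B ⟨
        imageSet g′ B                 ≡⟨ g′-fixes-B ⟩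
        B                             ∎
        where open ≡-Reasoning

  fixesPoint⇔fixesSet : ∀ g → G g → FixesPoint g p ⇔ FixesSet g B
  fixesPoint⇔fixesSet g Gg = mk⇔ (Gₚ-fixes-B g Gg) (fixesSet⇒fixesPoint g Gg)

  fixesPoint⇔fixesSet-translate : ∀ h g → G g → FixesPoint g (p ∙ h) ⇔ FixesSet g (translate H B h)
  fixesPoint⇔fixesSet-translate h g Gg = begin
    FixesPoint g (p ∙ h)          ≈⟨ conj-fixesPoint h g p ⟨
    FixesPoint (conj h g) p       ≈⟨ fixesPoint⇔fixesSet (conj h g) (conj-closed h g Gg) ⟩
    FixesSet (conj h g) B         ≈⟨ conj-fixesSet h g B ⟩
    FixesSet g (translate H B h)  ∎
    where open ⇔-Reasoning

  FixedShift : Fin n → Set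
  FixedShift f = StabFixesPoint G p (p ∙ f)

  FixedShift-ε : FixedShift ε
  FixedShift-ε g Gg fixes-p = subst (FixesPoint g) (sym (identityʳ p)) fixes-p

  FixedShift-∙ : ∀ x y → FixedShift x → FixedShift y → FixedShift (x ∙ y)
  FixedShift-∙ x y Fx Fy g Gg fixes-p = subst (FixesPoint g) (assoc p x y)
    (to (conj-fixesPoint y g (p ∙ x))
      (Fx (conj y g) (conj-closed y g Gg) (from (conj-fixesPoint y g p) (Fy g Gg fixes-p))))

  FixedShift-subgroup : IsSubgroup H FixedShift
  FixedShift-subgroup = FiniteGroup.submonoid⇒subgroup H FixedShift FixedShift-ε FixedShift-∙

  fixedPoint⇒fixedBlock : ∀ q → StabFixesPoint G p q → StabFixesBlock G p (translate H B (p ⁻¹ ∙ q))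
  fixedPoint⇒fixedBlock q Gₚ-fixes-q g Gg fixes-p = to (fixesPoint⇔fixesSet-translate (p ⁻¹ ∙ q) g Gg)
    (subst (FixesPoint g) (sym (\\-leftDividesˡ p q)) (Gₚ-fixes-q g Gg fixes-p))

  fixedBlock⇒fixedPoint : ∀ h → StabFixesBlock G p (translate H B h) → StabFixesPoint G p (p ∙ h ⁻¹)
  fixedBlock⇒fixedPoint h Gₚ-fixes-Bh = IsSubgroup.has-inv FixedShift-subgroup h
    λ g Gg fixes-p → from (fixesPoint⇔fixesSet-translate h g Gg) (Gₚ-fixes-Bh g Gg fixes-p)

  fixedPoints : ∀ x → StabFixesPoint G p x ⇔ (∃ λ f → FixedShift f × x ≡ p ∙ f)
  fixedPoints x = mk⇔
    (λ Gₚ-fixes-x → p ⁻¹ ∙ x , subst (StabFixesPoint G p) (sym x≡p[p⁻¹x]) Gₚ-fixes-x , sym x≡p[p⁻¹x])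
    (λ { (f , Ff , refl) → Ff })
    where x≡p[p⁻¹x] = \\-leftDividesˡ p x

  fixedBlocks : ∀ C → (∃ λ f → C ≡ translate H B f)
    → BlockStabFixesBlock G B C ⇔ (∃ λ f → FixedShift f × C ≡ translate H B f)
  fixedBlocks C (f , C≡Bf) = mk⇔
    (λ G_B-fixes-C → f , (λ g Gg fixes-p → from (fixesPoint⇔fixesSet-translate f g Gg)
                               (subst (FixesSet g) C≡Bf (G_B-fixes-C g Gg (Gₚ-fixes-B g Gg fixes-p))))
                       , C≡Bf)
    (λ { (f′ , Ff′ , refl) g Gg fixes-B →
           to (fixesPoint⇔fixesSet-translate f′ g Gg) (Ff′ g Gg (fixesSet⇒fixesPoint g Gg fixes-B)) })

module CayleyDesign {n : ℕ} (H : FinGroup n) (D : Subset n) (numBlocks≡n : numBlocks H D ≡ n) where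
  open FinGroup H
  open GroupProperties (toGroup H)
  open RightTranslation H

  translate-injective : ∀ x y → translate H D x ≡ translate H D y → x ≡ y
  translate-injective x y = Unique[tabulate]⇒injective (subst Unique (map-tabulate id (translate H D)) blocks-unique)
    where
      blocks-unique : Unique (blockList H D)
      blocks-unique = length-deduplicate≡⇒Unique (≡-dec Bool._≟_) (blockList H D)
        (trans numBlocks≡n (sym (trans (length-map (translate H D) (allFinL n)) (length-tabulate id))))

  block-regular : ∀ {B} → IsBlock H D B → ∀ c → translate H B c ≡ B → c ≡ ε
  block-regular (b , refl) c Bc≡B =
    identityʳ-unique b c (translate-injective (b ∙ c) b (trans (sym (translate-∙ D b c)) Bc≡B))

  block-translate : ∀ {B C} → IsBlock H D B → IsBlock H D C → ∃ λ f → C ≡ translate H B f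
  block-translate (b , refl) (c , refl) =
    b ⁻¹ ∙ c , sym (trans (translate-∙ D b (b ⁻¹ ∙ c)) (cong (translate H D) (\\-leftDividesˡ b c)))

proposition2p2 : ∀ {n : ℕ} (H : FinGroup n) (D : Subset n)
    → numBlocks H D ≡ n
    → (G : Permutation′ n → Set) → IsPermSubgroup G
    → (∀ g → G g → IsAut H D g)
    → (∀ h → G (rightTrans H h))
    → (p : Fin n) (B : Subset n) → IsBlock H D B → StabFixesBlock G p B
    → ((q : Fin n) → StabFixesPoint G p q
         → StabFixesBlock G p (translate H B (FinGroup._∙_ H (FinGroup._⁻¹ H p) q)))
      × ((h : Fin n) → StabFixesBlock G p (translate H B h)
         → StabFixesPoint G p (FinGroup._∙_ H p (FinGroup._⁻¹ H h)))
      × (Σ (Fin n → Set) λ F → IsSubgroup H F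
         × (∀ x → StabFixesPoint G p x ⇔ (∃ λ f → F f × x ≡ FinGroup._∙_ H p f))
         × (∀ C → IsBlock H D C
              → BlockStabFixesBlock G B C ⇔ (∃ λ f → F f × C ≡ translate H B f)))
proposition2p2 H D numBlocks≡n G G-subgroup _ G-rightTrans p B B-block Gₚ-fixes-B =
    fixedPoint⇒fixedBlock
  , fixedBlock⇒fixedPoint
  , FixedShift
  , FixedShift-subgroup
  , fixedPoints
  , λ C C-block → fixedBlocks C (block-translate B-block C-block)
  where
    open CayleyDesign H D numBlocks≡n
    open Stabilisers H G G-subgroup G-rightTrans p B (block-regular B-block) Gₚ-fixes-B
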